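{- Let $\mu:G\times H\to K$ be a graph homomorphism, let $g_0g_1$ be an oriented edge of $G$ and $h_0h_1$ an oriented edge of $H$, and let $C$ be a closed reduced walk in $G\times H$ starting and ending at $(g_0,h_0)$. Then $$[\mu(C)]^{2}=[\mu(C|_G\times h_0h_1)]\cdot[\mu(g_0g_1\times C|_H)]$$ in $\pi_{/\sim}(K)$.
   Context: All graphs are finite, simple, loopless. $G\times H$ is the tensor product (vertices $V(G)\times V(H)$, $(g,h)(g',h')$ an edge iff $gg'\in E(G)$ and $hh'\in E(H)$); $W|_G$, $W|_H$ are projections of a walk $W$ in $G\times H$. A walk is a sequence of oriented edges, each starting where the previous ends; $WW'$ is concatenation, $W^{ -1}$ the reverse, $\overline{W}$ the result of repeatedly deleting consecutive pairs $e,e^{ -1}$; a walk is reduced if $W=\overline{W}$. For a closed walk $C$ in $G$ (from $g$) and an oriented edge $h_0h_1$ of $H$, $C\times h_0h_1$ denotes the closed walk in $G\times H$ from $(g,h_0)$ whose projection to $G$ is $CC$ and whose projection to $H$ is $h_0h_1\,h_1h_0$ repeated $|C|$ times; symmetrically, for a closed walk $D$ in $H$ and an oriented edge $g_0g_1$ of $G$, $g_0g_1\times D$ has projection to $H$ equal to $DD$ and projection to $G$ equal to $g_0g_1\,g_1g_0$ repeated $|D|$ times. A square is a quadruple $v_1,\dots,v_4$ with $v_1v_2,v_2v_3,v_3v_4,v_4v_1$ edges. $\sim$ is the smallest equivalence relation on walks with $W\sim\overline{W}$ and $W\,v_1v_2\,v_2v_3\,W'\sim W\,v_1v_4\,v_4v_3\,W'$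 for all walks $W,W'$ and squares. $\pi_{/\sim}(K)$ is the groupoid of classes $[W]$ with $[W]\cdot[W']=[WW']$, $[W]^{ -1}=[W^{ -1}]$, and $X^2=X\cdot X$. -}

module Defs where

open import Data.Nat using (ℕ; _*_)
open import Data.Bool using (Bool; true; false; _∧_; T)
open import Data.Bool.Properties using (T-∧)
open import Data.Fin using (Fin)
import Data.Fin as Fin
open import Data.Fin.Properties using (*↔×)
open import Data.Product using (Σ; _×_; _,_; proj₁; proj₂)
open import Data.Product.Function.NonDependent.Propositional using (_×-↔_)
open import Function.Bundles using (_↔_; Inverse; Equivalence)
open import Function.Properties.Inverse using (↔-sym; ↔-trans)
open import Relation.Nullary using (Dec; yes; no)
open import Relation.Binary.PropositionalEquality
  using (_≡_; refl; sym; trans; cong; cong₂; subst)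

-- Adjacency is a Bool-valued, symmetric, irreflexive
-- relation, so there is at most one edge between two vertices (simple)
-- and no loops.

record Graph : Set₁ where
  field
    V      : Set
    size   : ℕ
    enum   : V ↔ Fin size
    adj    : V → V → Bool
    adj-sym    : ∀ u v → adj u v ≡ adj v u
    adj-irrefl : ∀ v → adj v v ≡ false

open Graph public

Edge : (G : Graph) → V G → V G → Set
Edge G u v = T (adj G u v)

edge-sym : (G : Graph) {u v : V G} → Edge G u v → Edge G v u
edge-sym G {u} {v} e = subst T (adj-sym G u v) e

_≟V_ : {G : Graph} → (x y : V G) → Dec (x ≡ y)
_≟V_ {G} x y with Inverse.to (enum G) x Fin.≟ Inverse.to (enum G) y
... | yes p = yes (trans (sym (Inverse.strictlyInverseʳ (enum G) x))
                   (trans (cong (Inverse.from (enum G)) p)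
                          (Inverse.strictlyInverseʳ (enum G) y)))
... | no ¬p = no (λ q → ¬p (cong (Inverse.to (enum G)) q))

∧-false : ∀ b → (false ∧ b) ≡ false
∧-false b = refl

_⊗_ : Graph → Graph → Graph
G ⊗ H = record
  { V = V G × V H
  ; size = size G * size H
  ; enum = ↔-trans (enum G ×-↔ enum H) (↔-sym *↔×)
  ; adj = λ p q → adj G (proj₁ p) (proj₁ q) ∧ adj H (proj₂ p) (proj₂ q)
  ; adj-sym = λ p q → cong₂ _∧_ (adj-sym G (proj₁ p) (proj₁ q))
                                (adj-sym H (proj₂ p) (proj₂ q))
  ; adj-irrefl = λ p → cong (_∧ adj H (proj₂ p) (proj₂ p)) (adj-irrefl G (proj₁ p))
  }

pairEdge : (G H : Graph) {g g' : V G} {h h' : V H} →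
           Edge G g g' → Edge H h h' → Edge (G ⊗ H) (g , h) (g' , h')
pairEdge G H d e = Equivalence.from T-∧ (d , e)

record Hom (G K : Graph) : Set where
  field
    fun  : V G → V K
    pres : ∀ {u v} → Edge G u v → Edge K (fun u) (fun v)

open Hom public

infixr 5 _∷_ _++_

data Walk (G : Graph) : V G → V G → Set where
  []  : {v : V G} → Walk G v v
  _∷_ : {u w v : V G} → Edge G u w → Walk G w v → Walk G u v

length : {G : Graph} {u v : V G} → Walk G u v → ℕ
length [] = 0
length (_ ∷ W) = ℕ.suc (length W)
  where import Data.Nat as ℕ

_++_ : {G : Graph} {u v w : V G} → Walk G u v → Walk G v w → Walk G u w
[] ++ W' = W'
(e ∷ W) ++ W' = e ∷ (W ++ W')

reverse : {G : Graph} {u v : V G} → Walk G u v → Walk G v u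
reverse [] = []
reverse {G} (e ∷ W) = reverse W ++ (edge-sym G e ∷ [])

-- reduction W̄: delete consecutive pairs e, e⁻¹ (in a simple graph the
-- inverse of the oriented edge uw is the oriented edge wu).  Computed by
-- the standard stack algorithm, giving the (unique) fully reduced walk.
cancel : {G : Graph} {u w v : V G} → Edge G u w → Walk G w v → Walk G u v
cancel e [] = e ∷ []
cancel {G} {u} e (_∷_ {w = x} e' W) with _≟V_ {G} x u
... | yes refl = W
... | no _     = e ∷ e' ∷ W

reduce : {G : Graph} {u v : V G} → Walk G u v → Walk G u v
reduce [] = []
reduce (e ∷ W) = cancel e (reduce W)

Reduced : {G : Graph} {u v : V G} → Walk G u v → Set
Reduced W = W ≡ reduce W

data _∼_ {G : Graph} {a b : V G} : Walk G a b → Walk G a b → Set where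
  ∼-reduce : (W : Walk G a b) → W ∼ reduce W
  ∼-square : {v₁ v₂ v₃ v₄ : V G}
             (W : Walk G a v₁) (W' : Walk G v₃ b)
             (e₁₂ : Edge G v₁ v₂) (e₂₃ : Edge G v₂ v₃)
             (e₃₄ : Edge G v₃ v₄) (e₄₁ : Edge G v₄ v₁) →
             (W ++ e₁₂ ∷ e₂₃ ∷ W') ∼
             (W ++ edge-sym G e₄₁ ∷ edge-sym G e₃₄ ∷ W')
  ∼-refl  : {W : Walk G a b} → W ∼ W
  ∼-sym   : {W W' : Walk G a b} → W ∼ W' → W' ∼ W
  ∼-trans : {W W' W'' : Walk G a b} → W ∼ W' → W' ∼ W'' → W ∼ W''

mapW : {G K : Graph} (μ : Hom G K) {u v : V G} →
       Walk G u v → Walk K (fun μ u) (fun μ v)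
mapW μ [] = []
mapW μ (e ∷ W) = pres μ e ∷ mapW μ W

projG : {G H : Graph} {p q : V (G ⊗ H)} →
        Walk (G ⊗ H) p q → Walk G (proj₁ p) (proj₁ q)
projG [] = []
projG {G} {H} (e ∷ W) = proj₁ (Equivalence.to T-∧ e) ∷ projG {G} {H} W

projH : {G H : Graph} {p q : V (G ⊗ H)} →
        Walk (G ⊗ H) p q → Walk H (proj₂ p) (proj₂ q)
projH [] = []
projH {G} {H} (e ∷ W) = proj₂ (Equivalence.to T-∧ e) ∷ projH {G} {H} W

alt : {G : Graph} {a b : V G} {X : Set} → Walk G a b → X → X → X
alt [] x y = x
alt (_ ∷ W) x y = alt W y x

zigL : (G H : Graph) {a b : V G} (W : Walk G a b) {x y : V H} →
       Edge H x y → Walk (G ⊗ H) (a , x) (b , alt W x y)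
zigL G H [] f = []
zigL G H (d ∷ W) f = pairEdge G H d f ∷ zigL G H W (edge-sym H f)

zigR : (G H : Graph) {a b : V H} (W : Walk H a b) {x y : V G} →
       Edge G x y → Walk (G ⊗ H) (x , a) (alt W x y , b)
zigR G H [] e = []
zigR G H (d ∷ W) e = pairEdge G H e d ∷ zigR G H W (edge-sym G e)

alt-++ : {G : Graph} {a b c : V G} {X : Set} (W : Walk G a b) (W' : Walk G b c)
         (x y : X) → alt (W ++ W') x y ≡ alt W' (alt W x y) (alt W y x)
alt-++ [] W' x y = refl
alt-++ (_ ∷ W) W' x y = alt-++ W W' y x

alt-twice : {G : Graph} {a b : V G} {X : Set} (W : Walk G a b) (x y : X) →
            alt W (alt W x y) (alt W y x) ≡ x
alt-twice [] x y = refl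
alt-twice (_ ∷ W) x y = alt-twice W x y

alt-double : {G : Graph} {a : V G} {X : Set} (C : Walk G a a) (x y : X) →
             alt (C ++ C) x y ≡ x
alt-double C x y = trans (alt-++ C C x y) (alt-twice C x y)

crossL : (G H : Graph) {g : V G} {h₀ h₁ : V H} →
         Walk G g g → Edge H h₀ h₁ → Walk (G ⊗ H) (g , h₀) (g , h₀)
crossL G H {g} C f =
  subst (λ h → Walk (G ⊗ H) (g , _) (g , h)) (alt-double C _ _) (zigL G H (C ++ C) f)

crossR : (G H : Graph) {g₀ g₁ : V G} {h : V H} →
         Edge G g₀ g₁ → Walk H h h → Walk (G ⊗ H) (g₀ , h) (g₀ , h)
crossR G H {h = h} e D =
  subst (λ g → Walk (G ⊗ H) (_ , h) (g , h)) (alt-double D _ _) (zigR G H (D ++ D) e)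

-- Call two walks homotopic (_≈_) when one is obtained from the other by
-- replacing a two-edge subwalk by the other half of a square, and by
-- inserting or deleting a backtrack e e⁻¹.  Homotopy implies ∼ (the
-- backtrack moves are absorbed by reduce, which ignores them) and is
-- preserved by graph homomorphisms.
--
-- The geometric heart is a decomposition in G × H: a walk X whose two
-- projections P = X|_G and Q = X|_H have even length is homotopic to the
-- walk that first runs along P while oscillating on an edge f of H, and
-- then runs along Q while oscillating on an edge e of G.  It is proved by
-- induction on X, two edges at a time, sliding each two-edge block past
-- the oscillating part with three square moves.  Applied to X = C C this
-- is C C ≈ (C|_G × h₀h₁) (g₀g₁ × C|_H), and corollary4 follows by mapping
-- along μ.
module Submission where

open import Defs
open import Data.Nat using (ℕ; zero; suc; _+_)
open import Data.Nat.Properties using (+-suc)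
open import Data.Product using (_,_; proj₁; proj₂)
open import Data.Bool.Properties using (T-irrelevant; T-∧)
open import Data.Unit using (⊤; tt)
open import Data.Empty using (⊥; ⊥-elim)
open import Relation.Nullary using (¬_; yes; no)
open import Function.Bundles using (Equivalence)
open import Level using (0ℓ)
open import Relation.Binary.Bundles using (Setoid)
import Relation.Binary.Reasoning.Setoid as SetoidReasoning
open import Relation.Binary.PropositionalEquality
  using (_≡_; refl; sym; cong; cong₂; subst; subst₂; module ≡-Reasoning)

++-assoc : {K : Graph} {a b c d : V K}
           (A : Walk K a b) (B : Walk K b c) (C : Walk K c d) →
           (A ++ B) ++ C ≡ A ++ (B ++ C)
++-assoc [] B C = refl
++-assoc (x ∷ A) B C = cong (x ∷_) (++-assoc A B C)

length-++ : {K : Graph} {a b c : V K} (A : Walk K a b) (B : Walk K b c) →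
            length (A ++ B) ≡ length A + length B
length-++ [] B = refl
length-++ (_ ∷ A) B = cong suc (length-++ A B)

mapW-++ : {G K : Graph} (μ : Hom G K) {a b c : V G}
          (A : Walk G a b) (B : Walk G b c) →
          mapW μ (A ++ B) ≡ mapW μ A ++ mapW μ B
mapW-++ μ [] B = refl
mapW-++ μ (x ∷ A) B = cong (pres μ x ∷_) (mapW-++ μ A B)

-- A walk is non-backtracking when no edge is followed by its reverse; the
-- output of reduce always is, and on such walks cancel d undoes cancel d⁻¹.

data NonBacktracking {K : Graph} : {u v : V K} → Walk K u v → Set where
  nb-[]  : {u : V K} → NonBacktracking {K} {u} {u} []
  nb-one : {u w : V K} (e : Edge K u w) → NonBacktracking (e ∷ [])
  nb-∷   : {u w x v : V K} {e : Edge K u w} {e' : Edge K w x} {W : Walk K x v} →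
           ¬ (x ≡ u) → NonBacktracking (e' ∷ W) → NonBacktracking (e ∷ e' ∷ W)

nb-tail : {K : Graph} {u w v : V K} {e : Edge K u w} {W : Walk K w v} →
          NonBacktracking (e ∷ W) → NonBacktracking W
nb-tail (nb-one e) = nb-[]
nb-tail (nb-∷ _ nb) = nb

cancel-nb : {K : Graph} {u w v : V K} (e : Edge K u w) (R : Walk K w v) →
            NonBacktracking R → NonBacktracking (cancel e R)
cancel-nb e [] nb = nb-one e
cancel-nb {K} {u} e (_∷_ {w = x} e' W) nb with _≟V_ {K} x u
... | yes refl = nb-tail nb
... | no x≢u = nb-∷ x≢u nb

reduce-nb : {K : Graph} {u v : V K} (W : Walk K u v) → NonBacktracking (reduce W)
reduce-nb [] = nb-[]
reduce-nb (e ∷ W) = cancel-nb e (reduce W) (reduce-nb W)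

cancel-return : {K : Graph} {u w v : V K} (d : Edge K u w) (d' : Edge K w u)
                (R : Walk K u v) → cancel d (d' ∷ R) ≡ R
cancel-return {K} {u} d d' R with _≟V_ {K} u u
... | yes refl = refl
... | no u≢u = ⊥-elim (u≢u refl)

cancel-keep : {K : Graph} {u w v : V K} (d d₁ : Edge K u w) (R : Walk K w v) →
              NonBacktracking (d₁ ∷ R) → cancel d R ≡ d₁ ∷ R
cancel-keep d d₁ [] nb = cong (_∷ []) (T-irrelevant d d₁)
cancel-keep {K} {u} d d₁ (_∷_ {w = z} d₂ R) nb with _≟V_ {K} z u
cancel-keep d d₁ (d₂ ∷ R) (nb-∷ z≢u _) | yes refl = ⊥-elim (z≢u refl)
... | no _ = cong (λ d' → d' ∷ d₂ ∷ R) (T-irrelevant d d₁)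

cancel-cancel : {K : Graph} {u w v : V K} (d : Edge K u w) (d' : Edge K w u)
                (R : Walk K u v) → NonBacktracking R → cancel d (cancel d' R) ≡ R
cancel-cancel d d' [] nb = cancel-return d d' []
cancel-cancel {K} {u} {w} d d' (_∷_ {w = x} d₁ R) nb with _≟V_ {K} x w
... | yes refl = cancel-keep d d₁ R nb
... | no _ = cancel-return d d' (d₁ ∷ R)

reduce-++ʳ : {K : Graph} {a b c : V K} (A : Walk K a b) {B B' : Walk K b c} →
             reduce B ≡ reduce B' → reduce (A ++ B) ≡ reduce (A ++ B')
reduce-++ʳ [] p = p
reduce-++ʳ (e ∷ A) p = cong (cancel e) (reduce-++ʳ A p)

reduce-backtrack : {K : Graph} {a u v b : V K} (X : Walk K a u) (Y : Walk K u b)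
                   (d : Edge K u v) (d' : Edge K v u) →
                   reduce (X ++ d ∷ d' ∷ Y) ≡ reduce (X ++ Y)
reduce-backtrack X Y d d' = reduce-++ʳ X (cancel-cancel d d' (reduce Y) (reduce-nb Y))

-- The
-- square is recorded as two paths v₁v₂v₃ and v₁v₄v₃, which is the form in
-- which squares of G × H arise.

infix 4 _≈_
data _≈_ {K : Graph} {a b : V K} : Walk K a b → Walk K a b → Set where
  square    : {v₁ v₂ v₃ v₄ : V K} (X : Walk K a v₁) (Y : Walk K v₃ b)
              (e₁₂ : Edge K v₁ v₂) (e₂₃ : Edge K v₂ v₃)
              (e₁₄ : Edge K v₁ v₄) (e₄₃ : Edge K v₄ v₃) →
              (X ++ e₁₂ ∷ e₂₃ ∷ Y) ≈ (X ++ e₁₄ ∷ e₄₃ ∷ Y)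
  backtrack : {u v : V K} (X : Walk K a u) (Y : Walk K u b)
              (d : Edge K u v) (d' : Edge K v u) →
              (X ++ d ∷ d' ∷ Y) ≈ (X ++ Y)
  ≈-refl    : {W : Walk K a b} → W ≈ W
  ≈-sym     : {W W' : Walk K a b} → W ≈ W' → W' ≈ W
  ≈-trans   : {W W' W'' : Walk K a b} → W ≈ W' → W' ≈ W'' → W ≈ W''

≈-setoid : (K : Graph) (a b : V K) → Setoid 0ℓ 0ℓ
≈-setoid K a b = record
  { Carrier = Walk K a b
  ; _≈_ = _≈_
  ; isEquivalence = record { refl = ≈-refl ; sym = ≈-sym ; trans = ≈-trans }
  }

module ≈-Reasoning {K : Graph} {a b : V K} = SetoidReasoning (≈-setoid K a b)

∷-cong : {K : Graph} {a a' b : V K} (d : Edge K a' a) {W W' : Walk K a b} →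
         W ≈ W' → (d ∷ W) ≈ (d ∷ W')
∷-cong d (square X Y e₁₂ e₂₃ e₁₄ e₄₃) = square (d ∷ X) Y e₁₂ e₂₃ e₁₄ e₄₃
∷-cong d (backtrack X Y d₁ d₂) = backtrack (d ∷ X) Y d₁ d₂
∷-cong d ≈-refl = ≈-refl
∷-cong d (≈-sym p) = ≈-sym (∷-cong d p)
∷-cong d (≈-trans p q) = ≈-trans (∷-cong d p) (∷-cong d q)

++-congˡ : {K : Graph} {a b c : V K} {W W' : Walk K a b} →
           W ≈ W' → (Z : Walk K b c) → (W ++ Z) ≈ (W' ++ Z)
++-congˡ (square X Y e₁₂ e₂₃ e₁₄ e₄₃) Z
  rewrite ++-assoc X (e₁₂ ∷ e₂₃ ∷ Y) Z | ++-assoc X (e₁₄ ∷ e₄₃ ∷ Y) Z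
  = square X (Y ++ Z) e₁₂ e₂₃ e₁₄ e₄₃
++-congˡ (backtrack X Y d d') Z
  rewrite ++-assoc X (d ∷ d' ∷ Y) Z | ++-assoc X Y Z
  = backtrack X (Y ++ Z) d d'
++-congˡ ≈-refl Z = ≈-refl
++-congˡ (≈-sym p) Z = ≈-sym (++-congˡ p Z)
++-congˡ (≈-trans p q) Z = ≈-trans (++-congˡ p Z) (++-congˡ q Z)

mapW-cong : {G K : Graph} (μ : Hom G K) {a b : V G} {W W' : Walk G a b} →
            W ≈ W' → mapW μ W ≈ mapW μ W'
mapW-cong μ (square X Y e₁₂ e₂₃ e₁₄ e₄₃)
  rewrite mapW-++ μ X (e₁₂ ∷ e₂₃ ∷ Y) | mapW-++ μ X (e₁₄ ∷ e₄₃ ∷ Y)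
  = square (mapW μ X) (mapW μ Y) (pres μ e₁₂) (pres μ e₂₃) (pres μ e₁₄) (pres μ e₄₃)
mapW-cong μ (backtrack X Y d d')
  rewrite mapW-++ μ X (d ∷ d' ∷ Y) | mapW-++ μ X Y
  = backtrack (mapW μ X) (mapW μ Y) (pres μ d) (pres μ d')
mapW-cong μ ≈-refl = ≈-refl
mapW-cong μ (≈-sym p) = ≈-sym (mapW-cong μ p)
mapW-cong μ (≈-trans p q) = ≈-trans (mapW-cong μ p) (mapW-cong μ q)

-- Homotopic walks are ∼-equivalent: a square move is ∼-square, and a
-- backtrack does not change the reduced walk.
≈⇒∼ : {K : Graph} {a b : V K} {W W' : Walk K a b} → W ≈ W' → W ∼ W'
≈⇒∼ {K} (square X Y e₁₂ e₂₃ e₁₄ e₄₃) =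
  subst₂ (λ d d' → (X ++ e₁₂ ∷ e₂₃ ∷ Y) ∼ (X ++ d ∷ d' ∷ Y))
    (T-irrelevant _ e₁₄) (T-irrelevant _ e₄₃)
    (∼-square X Y e₁₂ e₂₃ (edge-sym K e₄₃) (edge-sym K e₁₄))
≈⇒∼ (backtrack X Y d d') =
  ∼-trans (∼-reduce _)
    (subst (_∼ (X ++ Y)) (sym (reduce-backtrack X Y d d')) (∼-sym (∼-reduce (X ++ Y))))
≈⇒∼ ≈-refl = ∼-refl
≈⇒∼ (≈-sym p) = ∼-sym (≈⇒∼ p)
≈⇒∼ (≈-trans p q) = ∼-trans (≈⇒∼ p) (≈⇒∼ q)

-- Walks of even length.  Parity is read off the length, so that an even
-- walk e₁ e₂ W is definitionally one with W even.

EvenN : ℕ → Set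
EvenN zero = ⊤
EvenN (suc zero) = ⊥
EvenN (suc (suc n)) = EvenN n

EvenN-irrelevant : (n : ℕ) (p q : EvenN n) → p ≡ q
EvenN-irrelevant zero tt tt = refl
EvenN-irrelevant (suc (suc n)) p q = EvenN-irrelevant n p q

EvenN-double : (n : ℕ) → EvenN (n + n)
EvenN-double zero = tt
EvenN-double (suc n) rewrite +-suc n n = EvenN-double n

Even : {K : Graph} {u v : V K} → Walk K u v → Set
Even W = EvenN (length W)

Even-double : {K : Graph} {a : V K} (W : Walk K a a) → Even (W ++ W)
Even-double W = subst EvenN (sym (length-++ W W)) (EvenN-double (length W))

module Tensor (G H : Graph) where

  GH : Graph
  GH = G ⊗ H

  pe : {g g' : V G} {h h' : V H} → Edge G g g' → Edge H h h' →
       Edge GH (g , h) (g' , h')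
  pe = pairEdge G H

  esG : {g g' : V G} → Edge G g g' → Edge G g' g
  esG = edge-sym G

  esH : {h h' : V H} → Edge H h h' → Edge H h' h
  esH = edge-sym H

  edgeG : {p q : V GH} → Edge GH p q → Edge G (proj₁ p) (proj₁ q)
  edgeG d = proj₁ (Equivalence.to T-∧ d)

  edgeH : {p q : V GH} → Edge GH p q → Edge H (proj₂ p) (proj₂ q)
  edgeH d = proj₂ (Equivalence.to T-∧ d)

  πG : {p q : V GH} → Walk GH p q → Walk G (proj₁ p) (proj₁ q)
  πG = projG {G} {H}

  πH : {p q : V GH} → Walk GH p q → Walk H (proj₂ p) (proj₂ q)
  πH = projH {G} {H}

  pe-proj : {p q : V GH} (d : Edge GH p q) → d ≡ pe (edgeG d) (edgeH d)
  pe-proj d = T-irrelevant _ _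

  πG-++ : {p q r : V GH} (A : Walk GH p q) (B : Walk GH q r) →
          πG (A ++ B) ≡ πG A ++ πG B
  πG-++ [] B = refl
  πG-++ (d ∷ A) B = cong (_ ∷_) (πG-++ A B)

  πH-++ : {p q r : V GH} (A : Walk GH p q) (B : Walk GH q r) →
          πH (A ++ B) ≡ πH A ++ πH B
  πH-++ [] B = refl
  πH-++ (d ∷ A) B = cong (_ ∷_) (πH-++ A B)

  swapH : {s t : V GH} {a a₁ a₂ : V G} {b c d₁ d₂ : V H}
          (X : Walk GH s (a , b)) (Y : Walk GH (a₂ , c) t)
          (g₁ : Edge G a a₁) (g₂ : Edge G a₁ a₂)
          (h₁ : Edge H b d₁) (h₂ : Edge H d₁ c) (k₁ : Edge H b d₂) (k₂ : Edge H d₂ c) →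
          (X ++ pe g₁ h₁ ∷ pe g₂ h₂ ∷ Y) ≈ (X ++ pe g₁ k₁ ∷ pe g₂ k₂ ∷ Y)
  swapH X Y g₁ g₂ h₁ h₂ k₁ k₂ = square X Y (pe g₁ h₁) (pe g₂ h₂) (pe g₁ k₁) (pe g₂ k₂)

  swapG : {s t : V GH} {a c d₁ d₂ : V G} {b b₁ b₂ : V H}
          (X : Walk GH s (a , b)) (Y : Walk GH (c , b₂) t)
          (g₁ : Edge G a d₁) (g₂ : Edge G d₁ c) (k₁ : Edge G a d₂) (k₂ : Edge G d₂ c)
          (h₁ : Edge H b b₁) (h₂ : Edge H b₁ b₂) →
          (X ++ pe g₁ h₁ ∷ pe g₂ h₂ ∷ Y) ≈ (X ++ pe k₁ h₁ ∷ pe k₂ h₂ ∷ Y)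
  swapG X Y g₁ g₂ k₁ k₂ h₁ h₂ = square X Y (pe g₁ h₁) (pe g₂ h₂) (pe k₁ h₁) (pe k₂ h₂)

  -- They are zigL, zigR with the end vertex fixed by the parity.
  zigzagG : {a a' : V G} {b y : V H} (P : Walk G a a') → Even P → Edge H b y →
            Walk GH (a , b) (a' , b)
  zigzagG [] _ f = []
  zigzagG (g₁ ∷ []) () f
  zigzagG (g₁ ∷ g₂ ∷ P) ev f = pe g₁ f ∷ pe g₂ (esH f) ∷ zigzagG P ev (esH (esH f))

  zigzagH : {b b' : V H} {a x : V G} (Q : Walk H b b') → Even Q → Edge G a x →
            Walk GH (a , b) (a , b')
  zigzagH [] _ e = []
  zigzagH (h₁ ∷ []) () e
  zigzagH (h₁ ∷ h₂ ∷ Q) ev e = pe e h₁ ∷ pe (esG e) h₂ ∷ zigzagH Q ev (esG (esG e))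

  zigzagG-cong : {a a' : V G} {b y : V H} {P P' : Walk G a a'} → P ≡ P' →
                 (ev : Even P) (ev' : Even P') (f : Edge H b y) →
                 zigzagG P ev f ≡ zigzagG P' ev' f
  zigzagG-cong {P = P} refl ev ev' f =
    cong (λ ev'' → zigzagG P ev'' f) (EvenN-irrelevant (length P) ev ev')

  zigzagH-cong : {b b' : V H} {a x : V G} {Q Q' : Walk H b b'} → Q ≡ Q' →
                 (ev : Even Q) (ev' : Even Q') (e : Edge G a x) →
                 zigzagH Q ev e ≡ zigzagH Q' ev' e
  zigzagH-cong {Q = Q} refl ev ev' e =
    cong (λ ev'' → zigzagH Q ev'' e) (EvenN-irrelevant (length Q) ev ev')

  -- Retargeting the end vertex of a walk along an equation in one coordinate;
  -- this is how crossL and crossR make zigL and zigR closed.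
  retargetH : {s : V GH} {a' : V G} {h h' : V H} → h ≡ h' →
              Walk GH s (a' , h) → Walk GH s (a' , h')
  retargetH p W = subst (λ h → Walk GH _ (_ , h)) p W

  retargetG : {s : V GH} {b' : V H} {g g' : V G} → g ≡ g' →
              Walk GH s (g , b') → Walk GH s (g' , b')
  retargetG p W = subst (λ g → Walk GH _ (g , _)) p W

  -- Retargeting only affects the last vertex, so it passes under an edge.
  retargetH-∷ : {u w : V GH} {a' : V G} {h h' : V H} (p : h ≡ h')
                (d : Edge GH u w) (W : Walk GH w (a' , h)) →
                retargetH p (d ∷ W) ≡ d ∷ retargetH p W
  retargetH-∷ refl d W = refl

  retargetG-∷ : {u w : V GH} {b' : V H} {g g' : V G} (p : g ≡ g')
                (d : Edge GH u w) (W : Walk GH w (g , b')) →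
                retargetG p (d ∷ W) ≡ d ∷ retargetG p W
  retargetG-∷ refl d W = refl

  zigL-even : {a a' : V G} {b y : V H} (P : Walk G a a') (ev : Even P)
              (f : Edge H b y) (p : alt P b y ≡ b) →
              retargetH p (zigL G H P f) ≡ zigzagG P ev f
  zigL-even [] ev f refl = refl
  zigL-even (g₁ ∷ []) () f p
  zigL-even (g₁ ∷ g₂ ∷ P) ev f p = begin
    retargetH p (pe g₁ f ∷ pe g₂ (esH f) ∷ zigL G H P (esH (esH f)))
      ≡⟨ retargetH-∷ p (pe g₁ f) _ ⟩
    pe g₁ f ∷ retargetH p (pe g₂ (esH f) ∷ zigL G H P (esH (esH f)))
      ≡⟨ cong (pe g₁ f ∷_) (retargetH-∷ p (pe g₂ (esH f)) _) ⟩
    pe g₁ f ∷ pe g₂ (esH f) ∷ retargetH p (zigL G H P (esH (esH f)))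
      ≡⟨ cong (λ W → pe g₁ f ∷ pe g₂ (esH f) ∷ W) (zigL-even P ev (esH (esH f)) p) ⟩
    pe g₁ f ∷ pe g₂ (esH f) ∷ zigzagG P ev (esH (esH f))
      ∎
    where open ≡-Reasoning

  zigR-even : {b b' : V H} {a x : V G} (Q : Walk H b b') (ev : Even Q)
              (e : Edge G a x) (p : alt Q a x ≡ a) →
              retargetG p (zigR G H Q e) ≡ zigzagH Q ev e
  zigR-even [] ev e refl = refl
  zigR-even (h₁ ∷ []) () e p
  zigR-even (h₁ ∷ h₂ ∷ Q) ev e p = begin
    retargetG p (pe e h₁ ∷ pe (esG e) h₂ ∷ zigR G H Q (esG (esG e)))
      ≡⟨ retargetG-∷ p (pe e h₁) _ ⟩
    pe e h₁ ∷ retargetG p (pe (esG e) h₂ ∷ zigR G H Q (esG (esG e)))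
      ≡⟨ cong (pe e h₁ ∷_) (retargetG-∷ p (pe (esG e) h₂) _) ⟩
    pe e h₁ ∷ pe (esG e) h₂ ∷ retargetG p (zigR G H Q (esG (esG e)))
      ≡⟨ cong (λ W → pe e h₁ ∷ pe (esG e) h₂ ∷ W) (zigR-even Q ev (esG (esG e)) p) ⟩
    pe e h₁ ∷ pe (esG e) h₂ ∷ zigzagH Q ev (esG (esG e))
      ∎
    where open ≡-Reasoning

  -- A two-edge block (g₁,h₁)(g₂,h₂) can be split into its G-part, oscillating
  -- on any edge f of H, followed by its H-part, oscillating on any edge e of
  -- G: insert a backtrack, then one square in each coordinate.
  split-block : {a a₁ a' x : V G} {b c₁ c y : V H}
                (g₁ : Edge G a a₁) (g₂ : Edge G a₁ a') (h₁ : Edge H b c₁) (h₂ : Edge H c₁ c)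
                (f : Edge H b y) (e : Edge G a' x) →
                (pe g₁ h₁ ∷ pe g₂ h₂ ∷ []) ≈
                (pe g₁ f ∷ pe g₂ (esH f) ∷ pe e h₁ ∷ pe (esG e) h₂ ∷ [])
  split-block g₁ g₂ h₁ h₂ f e = begin
    pe g₁ h₁ ∷ pe g₂ h₂ ∷ []
      ≈⟨ backtrack (pe g₁ h₁ ∷ []) (pe g₂ h₂ ∷ []) (pe g₂ (esH h₁)) (pe (esG g₂) h₁) ⟨
    pe g₁ h₁ ∷ pe g₂ (esH h₁) ∷ pe (esG g₂) h₁ ∷ pe g₂ h₂ ∷ []
      ≈⟨ swapH [] (pe (esG g₂) h₁ ∷ pe g₂ h₂ ∷ []) g₁ g₂ h₁ (esH h₁) f (esH f) ⟩
    pe g₁ f ∷ pe g₂ (esH f) ∷ pe (esG g₂) h₁ ∷ pe g₂ h₂ ∷ []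
      ≈⟨ swapG (pe g₁ f ∷ pe g₂ (esH f) ∷ []) [] (esG g₂) g₂ e (esG e) h₁ h₂ ⟩
    pe g₁ f ∷ pe g₂ (esH f) ∷ pe e h₁ ∷ pe (esG e) h₂ ∷ []
      ∎
    where open ≈-Reasoning

  commute-block : {a a₁ m p m₂ : V G} {b c₁ c y y' : V H} {t : V GH}
                  (g₁ : Edge G a a₁) (g₂ : Edge G a₁ m) (p₁ : Edge G m p) (p₂ : Edge G p m₂)
                  (h₁ : Edge H b c₁) (h₂ : Edge H c₁ c) (f : Edge H b y) (f' : Edge H c y')
                  (Y : Walk GH (m₂ , c) t) →
                  (pe g₁ h₁ ∷ pe g₂ h₂ ∷ pe p₁ f' ∷ pe p₂ (esH f') ∷ Y) ≈
                  (pe g₁ f ∷ pe g₂ (esH f) ∷ pe p₁ h₁ ∷ pe p₂ h₂ ∷ Y)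
  commute-block g₁ g₂ p₁ p₂ h₁ h₂ f f' Y = begin
    pe g₁ h₁ ∷ pe g₂ h₂ ∷ pe p₁ f' ∷ pe p₂ (esH f') ∷ Y
      ≈⟨ swapH (pe g₁ h₁ ∷ pe g₂ h₂ ∷ []) Y p₁ p₂ f' (esH f') (esH h₂) h₂ ⟩
    pe g₁ h₁ ∷ pe g₂ h₂ ∷ pe p₁ (esH h₂) ∷ pe p₂ h₂ ∷ Y
      ≈⟨ swapH (pe g₁ h₁ ∷ []) (pe p₂ h₂ ∷ Y) g₂ p₁ h₂ (esH h₂) (esH h₁) h₁ ⟩
    pe g₁ h₁ ∷ pe g₂ (esH h₁) ∷ pe p₁ h₁ ∷ pe p₂ h₂ ∷ Y
      ≈⟨ swapH [] (pe p₁ h₁ ∷ pe p₂ h₂ ∷ Y) g₁ g₂ h₁ (esH h₁) f (esH f) ⟩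
    pe g₁ f ∷ pe g₂ (esH f) ∷ pe p₁ h₁ ∷ pe p₂ h₂ ∷ Y
      ∎
    where open ≈-Reasoning

  slide-block : {a a₁ m a' x : V G} {b c₁ c y y' : V H}
                (g₁ : Edge G a a₁) (g₂ : Edge G a₁ m) (h₁ : Edge H b c₁) (h₂ : Edge H c₁ c)
                (P : Walk G m a') (ev : Even P) (f' : Edge H c y') (f : Edge H b y)
                (e : Edge G a' x) →
                (pe g₁ h₁ ∷ pe g₂ h₂ ∷ zigzagG P ev f') ≈
                (zigzagG (g₁ ∷ g₂ ∷ P) ev f ++ pe e h₁ ∷ pe (esG e) h₂ ∷ [])
  slide-block g₁ g₂ h₁ h₂ [] ev f' f e = split-block g₁ g₂ h₁ h₂ f e
  slide-block g₁ g₂ h₁ h₂ (p₁ ∷ []) () f' f e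
  slide-block g₁ g₂ h₁ h₂ (p₁ ∷ p₂ ∷ P) ev f' f e =
    ≈-trans (commute-block g₁ g₂ p₁ p₂ h₁ h₂ f f' (zigzagG P ev (esH (esH f'))))
            (∷-cong (pe g₁ f) (∷-cong (pe g₂ (esH f))
              (slide-block p₁ p₂ h₁ h₂ P ev (esH (esH f')) (esH (esH f)) e)))

  decompose : {a a' x : V G} {b b' y : V H} (X : Walk GH (a , b) (a' , b'))
              (evG : Even (πG X)) (evH : Even (πH X))
              (f : Edge H b y) (e : Edge G a' x) →
              X ≈ (zigzagG (πG X) evG f ++ zigzagH (πH X) evH e)
  decompose [] evG evH f e = ≈-refl
  decompose (d ∷ []) () evH f e
  decompose {a} {a'} {_} {b} {b'} (_∷_ {w = p} d₁ (_∷_ {w = q} d₂ X)) evG evH f e = begin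
    d₁ ∷ d₂ ∷ X
      ≈⟨ ∷-cong d₁ (∷-cong d₂ (decompose X evG evH (esH h₂) (esG (esG e)))) ⟩
    d₁ ∷ d₂ ∷ rest
      ≡⟨ cong₂ (λ d d' → d ∷ d' ∷ rest) (pe-proj d₁) (pe-proj d₂) ⟩
    (pe g₁ h₁ ∷ pe g₂ h₂ ∷ zigzagG (πG X) evG (esH h₂)) ++ zigzagH (πH X) evH (esG (esG e))
      ≈⟨ ++-congˡ (slide-block g₁ g₂ h₁ h₂ (πG X) evG (esH h₂) f e) _ ⟩
    (zigzagG (g₁ ∷ g₂ ∷ πG X) evG f ++ pe e h₁ ∷ pe (esG e) h₂ ∷ []) ++
      zigzagH (πH X) evH (esG (esG e))
      ≡⟨ ++-assoc (zigzagG (g₁ ∷ g₂ ∷ πG X) evG f) _ _ ⟩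
    zigzagG (g₁ ∷ g₂ ∷ πG X) evG f ++ zigzagH (h₁ ∷ h₂ ∷ πH X) evH e
      ∎
    where
    open ≈-Reasoning
    g₁ : Edge G a (proj₁ p)
    g₁ = edgeG d₁
    h₁ : Edge H b (proj₂ p)
    h₁ = edgeH d₁
    g₂ : Edge G (proj₁ p) (proj₁ q)
    g₂ = edgeG d₂
    h₂ : Edge H (proj₂ p) (proj₂ q)
    h₂ = edgeH d₂
    rest : Walk GH q (a' , b')
    rest = zigzagG (πG X) evG (esH h₂) ++ zigzagH (πH X) evH (esG (esG e))

  crossL-zigzag : {g : V G} {h₀ h₁ : V H} (P : Walk G g g) (ev : Even (P ++ P))
                  (f : Edge H h₀ h₁) → crossL G H P f ≡ zigzagG (P ++ P) ev f
  crossL-zigzag P ev f = zigL-even (P ++ P) ev f (alt-double P _ _)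

  crossR-zigzag : {h : V H} {g₀ g₁ : V G} (Q : Walk H h h) (ev : Even (Q ++ Q))
                  (e : Edge G g₀ g₁) → crossR G H e Q ≡ zigzagH (Q ++ Q) ev e
  crossR-zigzag Q ev e = zigR-even (Q ++ Q) ev e (alt-double Q _ _)

  doubled-decomposition : {g₀ g₁ : V G} {h₀ h₁ : V H}
                          (e : Edge G g₀ g₁) (f : Edge H h₀ h₁)
                          (C : Walk GH (g₀ , h₀) (g₀ , h₀)) →
                          (C ++ C) ≈ (crossL G H (πG C) f ++ crossR G H e (πH C))
  doubled-decomposition e f C = begin
    C ++ C
      ≈⟨ decompose (C ++ C) evG evH f e ⟩
    zigzagG (πG (C ++ C)) evG f ++ zigzagH (πH (C ++ C)) evH e
      ≡⟨ cong₂ _++_ (zigzagG-cong (πG-++ C C) evG (Even-double (πG C)) f)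
                    (zigzagH-cong (πH-++ C C) evH (Even-double (πH C)) e) ⟩
    zigzagG (πG C ++ πG C) (Even-double (πG C)) f ++
      zigzagH (πH C ++ πH C) (Even-double (πH C)) e
      ≡⟨ cong₂ _++_ (crossL-zigzag (πG C) (Even-double (πG C)) f)
                    (crossR-zigzag (πH C) (Even-double (πH C)) e) ⟨
    crossL G H (πG C) f ++ crossR G H e (πH C)
      ∎
    where
    open ≈-Reasoning
    evG : Even (πG (C ++ C))
    evG = subst Even (sym (πG-++ C C)) (Even-double (πG C))
    evH : Even (πH (C ++ C))
    evH = subst Even (sym (πH-++ C C)) (Even-double (πH C))

corollary4 : (G H K : Graph) (μ : Hom (G ⊗ H) K)
             {g₀ g₁ : V G} {h₀ h₁ : V H}
             (e : Edge G g₀ g₁) (f : Edge H h₀ h₁)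
             (C : Walk (G ⊗ H) (g₀ , h₀) (g₀ , h₀)) → Reduced C →
             (mapW μ C ++ mapW μ C) ∼
             (mapW μ (crossL G H (projG {G} {H} C) f) ++
              mapW μ (crossR G H e (projH {G} {H} C)))
corollary4 G H K μ e f C _ = ≈⇒∼ (begin
  mapW μ C ++ mapW μ C
    ≡⟨ mapW-++ μ C C ⟨
  mapW μ (C ++ C)
    ≈⟨ mapW-cong μ (Tensor.doubled-decomposition G H e f C) ⟩
  mapW μ (crossL G H (projG {G} {H} C) f ++ crossR G H e (projH {G} {H} C))
    ≡⟨ mapW-++ μ (crossL G H (projG {G} {H} C) f) (crossR G H e (projH {G} {H} C)) ⟩
  mapW μ (crossL G H (projG {G} {H} C) f) ++ mapW μ (crossR G H e (projH {G} {H} C))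
    ∎)
  where open ≈-Reasoning
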